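{- Every total function $f:\omega\to\omega$ which is approximable from above is bounded-truth-table equivalent with norm $2$ to the distance function of some computable connected graph; that is, there is a computable connected graph with distance function $d$ such that $f\le_{2\text{ -btt}} d$ and $d\le_{2\text{ -btt}} f$.
   Context: A graph is computable if its domain is $\omega$ or a finite initial segment of $\omega$ and its (symmetric, irreflexive) edge relation is computable. The distance function of a connected graph gives the length of the shortest path between two nodes; it is regarded as a function on $\omega$ via a fixed computable pairing of $\omega^2$ with $\omega$. $f$ is approximable from above if $f(x)=\lim_s g(x,s)$ for a total computable $g$ nonincreasing in $s$. For total $\alpha,\beta$ on $\omega$, with $D_e$ the finite set with canonical index $e$: $\alpha\le_{k\text{ -btt}}\beta$ if there are total computable $p,q$ with $|D_{p(x)}|\le k$ and $\alpha(x)=q(x,\beta\restriction D_{p(x)})$ for all $x$. -}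

module Defs where

open import Data.Nat using (ℕ; zero; suc; _+_; _*_; _^_; _≤_; _<_; _≡ᵇ_)
open import Data.Nat.DivMod using (_/_; _%_)
open import Data.Fin using (Fin)
open import Data.Vec using (Vec; []; _∷_; lookup)
open import Data.List using (List; []; _∷_; map; length; filterᵇ; upTo)
open import Data.Bool using (Bool; true; false; if_then_else_)
open import Data.Maybe using (Maybe; just; nothing)
open import Data.Product using (Σ; _×_; _,_; ∃)
open import Relation.Binary.PropositionalEquality using (_≡_)
open import Relation.Nullary using (¬_)

-- A model of computation: (partial) μ-recursive function codes of arity n

data Code : ℕ → Set where
  zer  : ∀ {n} → Code n
  succ : Code 1
  proj : ∀ {n} → Fin n → Code n
  comp : ∀ {m n} → Code m → Vec (Code n) m → Code n
  prec : ∀ {n} → Code n → Code (suc (suc n)) → Code (suc n)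
  mu   : ∀ {n} → Code (suc n) → Code n

data _[_]↓_ : ∀ {n} → Code n → Vec ℕ n → ℕ → Set
data _[_]↓*_ : ∀ {m n} → Vec (Code n) m → Vec ℕ n → Vec ℕ m → Set

data _[_]↓_ where
  ev-zer  : ∀ {n} {xs : Vec ℕ n} → zer [ xs ]↓ 0
  ev-succ : ∀ {x} → succ [ x ∷ [] ]↓ suc x
  ev-proj : ∀ {n} {i : Fin n} {xs} → proj i [ xs ]↓ lookup xs i
  ev-comp : ∀ {m n} {f : Code m} {gs : Vec (Code n) m} {xs ys v} →
            gs [ xs ]↓* ys → f [ ys ]↓ v → comp f gs [ xs ]↓ v
  ev-prec-z : ∀ {n} {f : Code n} {g} {xs v} →
              f [ xs ]↓ v → prec f g [ 0 ∷ xs ]↓ v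
  ev-prec-s : ∀ {n} {f : Code n} {g} {xs y u v} →
              prec f g [ y ∷ xs ]↓ u → g [ y ∷ u ∷ xs ]↓ v →
              prec f g [ suc y ∷ xs ]↓ v
  ev-mu   : ∀ {n} {f : Code (suc n)} {xs y} →
            f [ y ∷ xs ]↓ 0 →
            (∀ z → z < y → Σ ℕ λ w → f [ z ∷ xs ]↓ suc w) →
            mu f [ xs ]↓ y

data _[_]↓*_ where
  ev-[] : ∀ {n} {xs : Vec ℕ n} → [] [ xs ]↓* []
  ev-∷  : ∀ {m n} {g : Code n} {gs : Vec (Code n) m} {xs v vs} →
          g [ xs ]↓ v → gs [ xs ]↓* vs → (g ∷ gs) [ xs ]↓* (v ∷ vs)

Computable₁ : (ℕ → ℕ) → Set
Computable₁ f = Σ (Code 1) λ c → ∀ x → c [ x ∷ [] ]↓ f x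

Computable₂ : (ℕ → ℕ → ℕ) → Set
Computable₂ f = Σ (Code 2) λ c → ∀ x y → c [ x ∷ y ∷ [] ]↓ f x y

tri : ℕ → ℕ
tri zero    = 0
tri (suc n) = suc n + tri n

⟨_,_⟩ : ℕ → ℕ → ℕ
⟨ x , y ⟩ = tri (x + y) + y

codeList : List ℕ → ℕ
codeList []       = 0
codeList (a ∷ as) = suc ⟨ a , codeList as ⟩

-- Canonical finite sets: D_e = { i | bit i of e is 1 }, listed increasingly

bit : ℕ → ℕ → Bool
bit e zero    = (e % 2) ≡ᵇ 1
bit e (suc i) = bit (e / 2) i

-- all elements of D_e are < e
D : ℕ → List ℕ
D e = filterᵇ (bit e) (upTo e)

-- code of β ↾ D_e (the values of β on D_e in increasing order of argument;
-- together with e, which q can compute from x, this determines β ↾ D_e)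
restrict : (ℕ → ℕ) → ℕ → ℕ
restrict β e = codeList (map β (D e))

_≤[_]btt_ : (ℕ → ℕ) → ℕ → (ℕ → ℕ) → Set
α ≤[ k ]btt β =
  Σ (ℕ → ℕ) λ p → Σ (ℕ → ℕ → ℕ) λ q →
    Computable₁ p × Computable₂ q ×
    (∀ x → length (D (p x)) ≤ k × α x ≡ q x (restrict β (p x)))

ApproxFromAbove : (ℕ → ℕ) → Set
ApproxFromAbove f =
  Σ (ℕ → ℕ → ℕ) λ g → Computable₂ g ×
    (∀ x s → g x (suc s) ≤ g x s) ×
    (∀ x → Σ ℕ λ s₀ → ∀ s → s₀ ≤ s → g x s ≡ f x)

-- Computable graphs: domain ω (bound = nothing) or {0,…,n-1} (bound = just n)

InBound : Maybe ℕ → ℕ → Set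
InBound nothing  x = Data.Unit.⊤ where import Data.Unit
InBound (just n) x = x < n

record CompGraph : Set where
  field
    bound  : Maybe ℕ
    E      : ℕ → ℕ → Bool
    E-comp : Computable₂ (λ x y → if E x y then 1 else 0)
    E-sym  : ∀ x y → E x y ≡ E y x
    E-irr  : ∀ x → E x x ≡ false

  Dom : ℕ → Set
  Dom = InBound bound

  data Walk : ℕ → ℕ → ℕ → Set where
    w-nil  : ∀ {x} → Dom x → Walk x x 0
    w-cons : ∀ {x z y n} → Dom x → E x z ≡ true → Walk z y n → Walk x y (suc n)

  Connected : Set
  Connected = ∀ x y → Dom x → Dom y → Σ ℕ λ n → Walk x y n

  IsDistance : (ℕ → ℕ) → Set
  IsDistance d =
    (∀ x y → Dom x → Dom y →
       Walk x y (d ⟨ x , y ⟩) × (∀ m → Walk x y m → d ⟨ x , y ⟩ ≤ m)) ×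
    (∀ x y → ¬ (Dom x × Dom y) → d ⟨ x , y ⟩ ≡ 0)

-- Let g be a computable approximation of f from above. For every x the graph has a hub h x (the hubs
-- form the path h 0, h 1, …), a tip t x, and for every stage s an infinite arm a x s 0, a x s 1, …
-- joined to h x at a x s 0 and to t x at a x s (g x s). The route from h x to t x through arm s has
-- length g x s + 2, and min_s g x s = f x, so d (h x, t x) = f x + 2: one query to d computes f x.
-- Conversely, every distance is given by an explicit formula in the spans f x + 2 of the
-- at most two gadgets involved, so two queries to f compute d. The formula is the graph distance
-- because it is realised by a walk, vanishes on the diagonal and changes by at most one along an edge.

module Submission where

open import Defs
open import Data.Nat
open import Data.Nat.Properties
open import Data.Bool using (Bool; true; false; if_then_else_; _∧_; _∨_; T)
open import Data.Bool.Properties using (∧-conicalˡ; ∧-conicalʳ; ∨-comm)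
open import Data.Nat.DivMod using (_/_; _%_; /-congˡ; m*n/n≡m; m*n%n≡0; [m+kn]%n≡m%n; +-distrib-/-∣ʳ)
open import Data.Nat.Divisibility using (m∣m*n)
open import Data.Fin using (Fin) renaming (zero to fzero; suc to fsuc)
open import Data.Vec using (Vec; []; _∷_; head; tail; lookup)
open import Data.List using ([]; _∷_; applyUpTo; filterᵇ; map; length)
open import Data.Product using (Σ; _×_; _,_; proj₁; proj₂)
open import Data.Maybe using (nothing)
open import Data.Unit using (tt)
open import Data.Empty using (⊥-elim)
open import Data.Sum using (_⊎_; inj₁; inj₂; swap)
open import Function using (id; _∘_)
open import Relation.Nullary using (¬_; yes; no; does)
open import Relation.Nullary.Decidable using (dec-true; dec-false)
open import Relation.Binary.Definitions using (tri<; tri≈; tri>)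
open import Relation.Binary.PropositionalEquality

module Computability where

  Computable : (n : ℕ) → (Vec ℕ n → ℕ) → Set
  Computable n f = Σ (Code n) λ c → ∀ xs → c [ xs ]↓ f xs

  indicator : Bool → ℕ
  indicator b = if b then 1 else 0

  ComputablePred : (n : ℕ) → (Vec ℕ n → Bool) → Set
  ComputablePred n P = Computable n (λ xs → indicator (P xs))

  uncurry₁ : (ℕ → ℕ) → Vec ℕ 1 → ℕ
  uncurry₁ f xs = f (head xs)

  uncurry₂ : (ℕ → ℕ → ℕ) → Vec ℕ 2 → ℕ
  uncurry₂ f xs = f (head xs) (head (tail xs))

  uncurry₃ : (ℕ → ℕ → ℕ → ℕ) → Vec ℕ 3 → ℕ
  uncurry₃ f xs = f (head xs) (head (tail xs)) (head (tail (tail xs)))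

  computable₁ : ∀ {f} → Computable 1 (uncurry₁ f) → Computable₁ f
  computable₁ (c , ev) = c , λ x → ev (x ∷ [])

  computable₂ : ∀ {f} → Computable 2 (uncurry₂ f) → Computable₂ f
  computable₂ (c , ev) = c , λ x y → ev (x ∷ y ∷ [])

  fromComputable₂ : ∀ {f} → Computable₂ f → Computable 2 (uncurry₂ f)
  fromComputable₂ (c , ev) = c , λ { (x ∷ y ∷ []) → ev x y }

  module _ {n : ℕ} where

    respᶜ : ∀ {f g} → (∀ xs → f xs ≡ g xs) → Computable n f → Computable n g
    respᶜ f≗g (c , ev) = c , λ xs → subst (c [ xs ]↓_) (f≗g xs) (ev xs)

    projection : (i : Fin n) → Computable n (λ xs → lookup xs i)
    projection i = proj i , λ _ → ev-proj

    lift₁ : ∀ {h x} → Computable 1 (uncurry₁ h) → Computable n x →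
            Computable n (λ xs → h (x xs))
    lift₁ (c , ev) (d , evx) = comp c (d ∷ []) ,
      λ xs → ev-comp (ev-∷ (evx xs) ev-[]) (ev _)

    lift₂ : ∀ {h x y} → Computable 2 (uncurry₂ h) → Computable n x → Computable n y →
            Computable n (λ xs → h (x xs) (y xs))
    lift₂ (c , ev) (d , evx) (e , evy) = comp c (d ∷ e ∷ []) ,
      λ xs → ev-comp (ev-∷ (evx xs) (ev-∷ (evy xs) ev-[])) (ev _)

    lift₃ : ∀ {h x y z} → Computable 3 (uncurry₃ h) →
            Computable n x → Computable n y → Computable n z →
            Computable n (λ xs → h (x xs) (y xs) (z xs))
    lift₃ (c , ev) (d , evx) (e , evy) (e′ , evz) = comp c (d ∷ e ∷ e′ ∷ []) ,
      λ xs → ev-comp (ev-∷ (evx xs) (ev-∷ (evy xs) (ev-∷ (evz xs) ev-[]))) (ev _)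

    sucᶜ : ∀ {x} → Computable n x → Computable n (λ xs → suc (x xs))
    sucᶜ = lift₁ {h = suc} (succ , λ { (_ ∷ []) → ev-succ })

    constᶜ : ∀ k → Computable n (λ _ → k)
    constᶜ zero    = zer , λ _ → ev-zer
    constᶜ (suc k) = sucᶜ (constᶜ k)

  var₀ : ∀ {n} → Computable (suc n) head
  var₀ = respᶜ (λ { (_ ∷ _) → refl }) (projection fzero)

  var₁ : ∀ {n} → Computable (2 + n) (λ xs → head (tail xs))
  var₁ = respᶜ (λ { (_ ∷ _ ∷ _) → refl }) (projection (fsuc fzero))

  primRec : ∀ {h : ℕ → ℕ → ℕ} base step →
    (∀ b → h 0 b ≡ base b) → (∀ y b → h (suc y) b ≡ step y (h y b) b) →
    Computable 1 (uncurry₁ base) → Computable 3 (uncurry₃ step) → Computable 2 (uncurry₂ h)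
  primRec {h} base step h-zero h-suc (c , evc) (d , evd) =
    prec c d , λ { (y ∷ b ∷ []) → go y b }
    where
    go : ∀ y b → prec c d [ y ∷ b ∷ [] ]↓ h y b
    go zero    b = subst (prec c d [ 0 ∷ b ∷ [] ]↓_) (sym (h-zero b)) (ev-prec-z (evc (b ∷ [])))
    go (suc y) b = subst (prec c d [ suc y ∷ b ∷ [] ]↓_) (sym (h-suc y b))
                         (ev-prec-s (go y b) (evd (y ∷ h y b ∷ b ∷ [])))

  primRec₁ : ∀ {h : ℕ → ℕ} step → (∀ y → h (suc y) ≡ step y (h y)) →
    Computable 2 (uncurry₂ step) → Computable 1 (uncurry₁ h)
  primRec₁ {h} step h-suc c =
    respᶜ (λ { (_ ∷ []) → refl })
      (lift₂ {h = λ y _ → h y}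
        (primRec {λ y _ → h y} (λ _ → h 0) (λ y u _ → step y u) (λ _ → refl) (λ y _ → h-suc y)
                 (constᶜ (h 0)) (lift₂ {h = step} c var₀ var₁))
        var₀ (constᶜ 0))

  minimise : ∀ (h : ℕ → ℕ → ℕ) {μh : ℕ → ℕ} → Computable 2 (uncurry₂ h) →
    (∀ x → h (μh x) x ≡ 0) → (∀ x z → z < μh x → Σ ℕ λ w → h z x ≡ suc w) →
    Computable 1 (uncurry₁ μh)
  minimise h {μh} (c , ev) root below = mu c , λ { (x ∷ []) →
    ev-mu (subst (c [ μh x ∷ x ∷ [] ]↓_) (root x) (ev _))
          (λ z z<μ → let (w , hz) = below x z z<μ in
                     w , subst (c [ z ∷ x ∷ [] ]↓_) hz (ev _)) }

  private
    ifZero : ℕ → ℕ → ℕ → ℕ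
    ifZero zero    a _ = a
    ifZero (suc _) _ b = b

    -- by recursion on the condition, with a step that returns its last argument
    ifZero-computable : Computable 3 (uncurry₃ ifZero)
    ifZero-computable = prec (proj fzero) (proj (fsuc (fsuc (fsuc fzero)))) ,
                        λ { (c ∷ a ∷ b ∷ []) → go c a b }
      where
      go : ∀ c a b → prec (proj fzero) (proj (fsuc (fsuc (fsuc fzero)))) [ c ∷ a ∷ b ∷ [] ]↓ ifZero c a b
      go zero    a b = ev-prec-z ev-proj
      go (suc c) a b = ev-prec-s (go c a b) ev-proj

    add : Computable 2 (uncurry₂ _+_)
    add = primRec {_+_} (λ b → b) (λ _ u _ → suc u) (λ _ → refl) (λ _ _ → refl) var₀ (sucᶜ var₁)

    predecessor : Computable 1 (uncurry₁ pred)
    predecessor = primRec₁ {pred} (λ y _ → y) (λ _ → refl) var₀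

    monus : Computable 2 (uncurry₂ _∸_)
    monus = respᶜ (λ { (_ ∷ _ ∷ []) → refl })
      (lift₂ {h = λ a b → b ∸ a}
        (primRec {λ a b → b ∸ a} (λ b → b) (λ _ u _ → pred u) (λ _ → refl)
                 (λ y b → sym (pred[m∸n]≡m∸[1+n] b y)) var₀ (lift₁ {h = pred} predecessor var₁))
        var₁ var₀)

  module _ {n : ℕ} where

    infixl 7 _⊓ᶜ_
    infixl 6 _+ᶜ_ _∸ᶜ_
    infix  4 _<ᵇᶜ_ _≡ᵇᶜ_
    infixr 3 _∧ᶜ_
    infixr 2 _∨ᶜ_
    infix  0 ifᶜ_then_else_

    _+ᶜ_ : ∀ {x y} → Computable n x → Computable n y → Computable n (λ xs → x xs + y xs)
    _+ᶜ_ = lift₂ {h = _+_} add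

    _∸ᶜ_ : ∀ {x y} → Computable n x → Computable n y → Computable n (λ xs → x xs ∸ y xs)
    _∸ᶜ_ = lift₂ {h = _∸_} monus

    predᶜ : ∀ {x} → Computable n x → Computable n (λ xs → pred (x xs))
    predᶜ = lift₁ {h = pred} predecessor

    ifᶜ_then_else_ : ∀ {P x y} → ComputablePred n P → Computable n x → Computable n y →
                     Computable n (λ xs → if P xs then x xs else y xs)
    ifᶜ_then_else_ {P} {x} {y} cP cx cy =
      respᶜ (λ xs → ifZero-indicator (P xs)) (lift₃ {h = ifZero} ifZero-computable cP cy cx)
      where
      ifZero-indicator : ∀ {a b} p → ifZero (indicator p) b a ≡ (if p then a else b)
      ifZero-indicator false = refl
      ifZero-indicator true  = refl

    _<ᵇᶜ_ : ∀ {x y} → Computable n x → Computable n y → ComputablePred n (λ xs → x xs <ᵇ y xs)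
    _<ᵇᶜ_ {x} {y} cx cy = respᶜ (λ xs → ifZero-<ᵇ (x xs) (y xs))
      (lift₃ {h = ifZero} ifZero-computable (sucᶜ cx ∸ᶜ cy) (constᶜ 1) (constᶜ 0))
      where
      ifZero-<ᵇ : ∀ a b → ifZero (suc a ∸ b) 1 0 ≡ indicator (a <ᵇ b)
      ifZero-<ᵇ a       zero          = refl
      ifZero-<ᵇ zero    (suc zero)    = refl
      ifZero-<ᵇ zero    (suc (suc b)) = refl
      ifZero-<ᵇ (suc a) (suc b)       = ifZero-<ᵇ a b

    _≡ᵇᶜ_ : ∀ {x y} → Computable n x → Computable n y → ComputablePred n (λ xs → x xs ≡ᵇ y xs)
    _≡ᵇᶜ_ {x} {y} cx cy = respᶜ (λ xs → ifZero-≡ᵇ (x xs) (y xs))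
      (lift₃ {h = ifZero} ifZero-computable ((cx ∸ᶜ cy) +ᶜ (cy ∸ᶜ cx)) (constᶜ 1) (constᶜ 0))
      where
      ifZero-≡ᵇ : ∀ a b → ifZero ((a ∸ b) + (b ∸ a)) 1 0 ≡ indicator (a ≡ᵇ b)
      ifZero-≡ᵇ zero    zero    = refl
      ifZero-≡ᵇ zero    (suc b) = refl
      ifZero-≡ᵇ (suc a) zero    = refl
      ifZero-≡ᵇ (suc a) (suc b) = ifZero-≡ᵇ a b

    _∧ᶜ_ : ∀ {P Q} → ComputablePred n P → ComputablePred n Q → ComputablePred n (λ xs → P xs ∧ Q xs)
    _∧ᶜ_ {P} cP cQ = respᶜ (λ xs → indicator-∧ (P xs)) (ifᶜ cP then cQ else constᶜ 0)
      where
      indicator-∧ : ∀ p {q} → (if p then indicator q else 0) ≡ indicator (p ∧ q)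
      indicator-∧ false = refl
      indicator-∧ true  = refl

    _∨ᶜ_ : ∀ {P Q} → ComputablePred n P → ComputablePred n Q → ComputablePred n (λ xs → P xs ∨ Q xs)
    _∨ᶜ_ {P} cP cQ = respᶜ (λ xs → indicator-∨ (P xs)) (ifᶜ cP then constᶜ 1 else cQ)
      where
      indicator-∨ : ∀ p {q} → (if p then 1 else indicator q) ≡ indicator (p ∨ q)
      indicator-∨ false = refl
      indicator-∨ true  = refl

    _⊓ᶜ_ : ∀ {x y} → Computable n x → Computable n y → Computable n (λ xs → x xs ⊓ y xs)
    _⊓ᶜ_ {x} {y} cx cy = respᶜ (λ xs → if-<ᵇ≡⊓ (x xs) (y xs)) (ifᶜ cx <ᵇᶜ cy then cx else cy)
      where
      if-<ᵇ≡⊓ : ∀ a b → (if a <ᵇ b then a else b) ≡ a ⊓ b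
      if-<ᵇ≡⊓ a b = trans (if-<ᵇ≡⊓′ a b) (sym (⊓≡⊓′ a b))
        where
        if-<ᵇ≡⊓′ : ∀ a b → (if a <ᵇ b then a else b) ≡ a ⊓′ b
        if-<ᵇ≡⊓′ a b with a <ᵇ b
        ... | false = refl
        ... | true  = refl

    ∣_-ᶜ_∣ : ∀ {x y} → Computable n x → Computable n y → Computable n (λ xs → ∣ x xs - y xs ∣)
    ∣_-ᶜ_∣ {x} {y} cx cy = respᶜ (λ xs → if-<ᵇ≡∣-∣ (x xs) (y xs))
      (ifᶜ cx <ᵇᶜ cy then cy ∸ᶜ cx else cx ∸ᶜ cy)
      where
      if-<ᵇ≡∣-∣ : ∀ a b → (if a <ᵇ b then b ∸ a else a ∸ b) ≡ ∣ a - b ∣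
      if-<ᵇ≡∣-∣ a b = trans (if-<ᵇ≡∣-∣′ a b) (sym (∣-∣≡∣-∣′ a b))
        where
        if-<ᵇ≡∣-∣′ : ∀ a b → (if a <ᵇ b then b ∸ a else a ∸ b) ≡ ∣ a - b ∣′
        if-<ᵇ≡∣-∣′ a b with a <ᵇ b
        ... | false = refl
        ... | true  = refl

  2^ᶜ_ : ∀ {n x} → Computable n x → Computable n (λ xs → 2 ^ x xs)
  2^ᶜ_ = lift₁ {h = 2 ^_}
    (primRec₁ {2 ^_} (λ _ u → u + (u + 0)) (λ _ → refl) (var₁ +ᶜ (var₁ +ᶜ constᶜ 0)))

module Pairing where

  open Computability

  next : ℕ × ℕ → ℕ × ℕ
  next (zero  , y) = suc y , 0
  next (suc x , y) = x , suc y

  unpair : ℕ → ℕ × ℕ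
  unpair zero    = 0 , 0
  unpair (suc n) = next (unpair n)

  π₁ π₂ : ℕ → ℕ
  π₁ n = proj₁ (unpair n)
  π₂ n = proj₂ (unpair n)

  pair-next : ∀ x y → ⟨ proj₁ (next (x , y)) , proj₂ (next (x , y)) ⟩ ≡ suc ⟨ x , y ⟩
  pair-next zero    y rewrite +-identityʳ y | +-identityʳ (y + tri y) = cong suc (+-comm y (tri y))
  pair-next (suc x) y rewrite +-suc x y | +-suc (tri (suc (x + y))) y = refl

  pair-unpair : ∀ n → ⟨ π₁ n , π₂ n ⟩ ≡ n
  pair-unpair zero    = refl
  pair-unpair (suc n) = trans (pair-next (π₁ n) (π₂ n)) (cong suc (pair-unpair n))

  unpair-diagonal : ∀ k y → y ≤ k → unpair (tri k + y) ≡ (k ∸ y , y)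
  unpair-diagonal zero    zero    _ = refl
  unpair-diagonal (suc k) zero    _
    rewrite +-identityʳ (k + tri k) | +-comm k (tri k) | unpair-diagonal k k ≤-refl | n∸n≡0 k = refl
  unpair-diagonal k       (suc y) y<k
    rewrite +-suc (tri k) y | unpair-diagonal k y (<⇒≤ y<k) | +-∸-assoc 1 y<k = refl

  unpair-pair : ∀ x y → unpair ⟨ x , y ⟩ ≡ (x , y)
  unpair-pair x y rewrite unpair-diagonal (x + y) y (m≤n+m y x) | m+n∸n≡m x y = refl

  π₁-pair : ∀ x y → π₁ ⟨ x , y ⟩ ≡ x
  π₁-pair x y = cong proj₁ (unpair-pair x y)

  π₂-pair : ∀ x y → π₂ ⟨ x , y ⟩ ≡ y
  π₂-pair x y = cong proj₂ (unpair-pair x y)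

  private
    diagonal : ℕ → ℕ
    diagonal n = π₁ n + π₂ n

    tri-mono-≤ : ∀ {m n} → m ≤ n → tri m ≤ tri n
    tri-mono-≤ {zero}          _         = z≤n
    tri-mono-≤ {suc m} {suc n} (s≤s m≤n) = +-mono-≤ (s≤s m≤n) (tri-mono-≤ m≤n)

    tri-diagonal≤ : ∀ n → tri (diagonal n) ≤ n
    tri-diagonal≤ n = subst (tri (diagonal n) ≤_) (pair-unpair n) (m≤m+n _ _)

    <tri-suc-diagonal : ∀ n → n < tri (suc (diagonal n))
    <tri-suc-diagonal n = subst (_< tri (suc (diagonal n))) (pair-unpair n)
      (subst₂ _≤_ (+-suc (tri (diagonal n)) (π₂ n)) (+-comm (tri (diagonal n)) (suc (diagonal n)))
        (+-monoʳ-≤ (tri (diagonal n)) (s≤s (m≤n+m (π₂ n) (π₁ n)))))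

    triangle : Computable 1 (uncurry₁ tri)
    triangle = primRec₁ {tri} (λ y u → suc y + u) (λ _ → refl) (sucᶜ var₀ +ᶜ var₁)

    -- the diagonal of n is the least k with n < tri (k + 1)
    diagonal-computable : Computable 1 (uncurry₁ diagonal)
    diagonal-computable = minimise (λ k n → suc n ∸ tri (suc k)) {diagonal}
      (sucᶜ var₁ ∸ᶜ lift₁ {h = tri} triangle (sucᶜ var₀))
      (λ n → m≤n⇒m∸n≡0 (<tri-suc-diagonal n))
      (λ n k k<diag → n ∸ tri (suc k) ,
         +-∸-assoc 1 (≤-trans (tri-mono-≤ k<diag) (tri-diagonal≤ n)))

    n∸tri-diagonal≡π₂ : ∀ n → n ∸ tri (diagonal n) ≡ π₂ n
    n∸tri-diagonal≡π₂ n = trans (cong (_∸ tri (diagonal n)) (sym (pair-unpair n)))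
                                (m+n∸m≡n (tri (diagonal n)) (π₂ n))

  module _ {n : ℕ} where

    π₂ᶜ : ∀ {x} → Computable n x → Computable n (λ xs → π₂ (x xs))
    π₂ᶜ {x} cx = respᶜ (λ xs → n∸tri-diagonal≡π₂ (x xs))
      (cx ∸ᶜ lift₁ {h = tri} triangle (lift₁ {h = diagonal} diagonal-computable cx))

    π₁ᶜ : ∀ {x} → Computable n x → Computable n (λ xs → π₁ (x xs))
    π₁ᶜ {x} cx = respᶜ (λ xs → m+n∸n≡m (π₁ (x xs)) (π₂ (x xs)))
      (lift₁ {h = diagonal} diagonal-computable cx ∸ᶜ π₂ᶜ cx)

    ⟨_,ᶜ_⟩ : ∀ {x y} → Computable n x → Computable n y → Computable n (λ xs → ⟨ x xs , y xs ⟩)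
    ⟨ cx ,ᶜ cy ⟩ = lift₁ {h = tri} triangle (cx +ᶜ cy) +ᶜ cy

module CanonicalSets where

  private
    2*m/2≡m : ∀ m → 2 * m / 2 ≡ m
    2*m/2≡m m = trans (/-congˡ (*-comm 2 m)) (m*n/n≡m m 2)

    2*m%2≡0 : ∀ m → 2 * m % 2 ≡ 0
    2*m%2≡0 m = trans (cong (_% 2) (*-comm 2 m)) (m*n%n≡0 m 2)

    [1+2*m]/2≡m : ∀ m → (1 + 2 * m) / 2 ≡ m
    [1+2*m]/2≡m m = trans (+-distrib-/-∣ʳ 1 {d = 2} (m∣m*n m)) (2*m/2≡m m)

    [1+2*m]%2≡1 : ∀ m → (1 + 2 * m) % 2 ≡ 1
    [1+2*m]%2≡1 m = trans (cong (λ e → (1 + e) % 2) (*-comm 2 m)) ([m+kn]%n≡m%n 1 m 2)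

    bit-0 : ∀ i → bit 0 i ≡ false
    bit-0 zero    = refl
    bit-0 (suc i) = bit-0 i

    bit-2*-zero : ∀ m → bit (2 * m) 0 ≡ false
    bit-2*-zero m = cong (_≡ᵇ 1) (2*m%2≡0 m)

    bit-2*-suc : ∀ m i → bit (2 * m) (suc i) ≡ bit m i
    bit-2*-suc m i = cong (λ e → bit e i) (2*m/2≡m m)

    bit-1+2*-zero : ∀ m → bit (1 + 2 * m) 0 ≡ true
    bit-1+2*-zero m = cong (_≡ᵇ 1) ([1+2*m]%2≡1 m)

    bit-1+2*-suc : ∀ m i → bit (1 + 2 * m) (suc i) ≡ bit m i
    bit-1+2*-suc m i = cong (λ e → bit e i) ([1+2*m]/2≡m m)

    bit-2^ : ∀ a i → bit (2 ^ a) i ≡ (i ≡ᵇ a)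
    bit-2^ zero    zero    = refl
    bit-2^ zero    (suc i) = bit-0 i
    bit-2^ (suc a) zero    = bit-2*-zero (2 ^ a)
    bit-2^ (suc a) (suc i) = trans (bit-2*-suc (2 ^ a) i) (bit-2^ a i)

    bit-2^+2^ : ∀ {a b} → a < b → ∀ i → bit (2 ^ a + 2 ^ b) i ≡ ((i ≡ᵇ a) ∨ (i ≡ᵇ b))
    bit-2^+2^ {zero}  {suc b} _ zero    = bit-1+2*-zero (2 ^ b)
    bit-2^+2^ {zero}  {suc b} _ (suc i) = trans (bit-1+2*-suc (2 ^ b) i) (bit-2^ b i)
    bit-2^+2^ {suc a} {suc b} a<b i =
      trans (cong (λ e → bit e i) (sym (*-distribˡ-+ 2 (2 ^ a) (2 ^ b)))) (halve i)
      where
      halve : ∀ i → bit (2 * (2 ^ a + 2 ^ b)) i ≡ ((i ≡ᵇ suc a) ∨ (i ≡ᵇ suc b))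
      halve zero    = bit-2*-zero (2 ^ a + 2 ^ b)
      halve (suc i) = trans (bit-2*-suc (2 ^ a + 2 ^ b) i) (bit-2^+2^ (s≤s⁻¹ a<b) i)

    n<2^n : ∀ n → n < 2 ^ n
    n<2^n zero    = z<s
    n<2^n (suc n) = +-mono-<-≤ (m^n>0 2 n) (≤-trans (n<2^n n) (m≤m+n (2 ^ n) 0))

    filterᵇ-none : ∀ n (f : ℕ → ℕ) (P : ℕ → Bool) → (∀ i → P (f i) ≡ false) →
                   filterᵇ P (applyUpTo f n) ≡ []
    filterᵇ-none zero    f P none = refl
    filterᵇ-none (suc n) f P none rewrite none 0 = filterᵇ-none n (f ∘ suc) P (none ∘ suc)

    filterᵇ-one : ∀ n (f : ℕ → ℕ) (P : ℕ → Bool) {a} → a < n → (∀ i → P (f i) ≡ (i ≡ᵇ a)) →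
                  filterᵇ P (applyUpTo f n) ≡ f a ∷ []
    filterᵇ-one (suc n) f P {zero}  _   one rewrite one 0 =
      cong (f 0 ∷_) (filterᵇ-none n (f ∘ suc) P (one ∘ suc))
    filterᵇ-one (suc n) f P {suc a} a<n one rewrite one 0 =
      filterᵇ-one n (f ∘ suc) P (s≤s⁻¹ a<n) (one ∘ suc)

    filterᵇ-two : ∀ n (f : ℕ → ℕ) (P : ℕ → Bool) {a b} → a < b → b < n →
                  (∀ i → P (f i) ≡ ((i ≡ᵇ a) ∨ (i ≡ᵇ b))) →
                  filterᵇ P (applyUpTo f n) ≡ f a ∷ f b ∷ []
    filterᵇ-two (suc n) f P {zero}  {suc b} _   b<n two rewrite two 0 =
      cong (f 0 ∷_) (filterᵇ-one n (f ∘ suc) P (s≤s⁻¹ b<n) (two ∘ suc))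
    filterᵇ-two (suc n) f P {suc a} {suc b} a<b b<n two rewrite two 0 =
      filterᵇ-two n (f ∘ suc) P (s≤s⁻¹ a<b) (s≤s⁻¹ b<n) (two ∘ suc)

  D-2^ : ∀ a → D (2 ^ a) ≡ a ∷ []
  D-2^ a = filterᵇ-one (2 ^ a) id (bit (2 ^ a)) (n<2^n a) (bit-2^ a)

  D-2^+2^ : ∀ {a b} → a < b → D (2 ^ a + 2 ^ b) ≡ a ∷ b ∷ []
  D-2^+2^ {a} {b} a<b = filterᵇ-two (2 ^ a + 2 ^ b) id (bit (2 ^ a + 2 ^ b)) a<b
    (≤-trans (n<2^n b) (m≤n+m (2 ^ b) (2 ^ a))) (bit-2^+2^ a<b)

module Queries where

  open Computability
  open Pairing
  open CanonicalSets

  first second : ℕ → ℕ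
  first  r = π₁ (pred r)
  second r = first (π₂ (pred r))

  first-codeList : ∀ a as → first (codeList (a ∷ as)) ≡ a
  first-codeList a as = π₁-pair a (codeList as)

  second-codeList : ∀ a b as → second (codeList (a ∷ b ∷ as)) ≡ b
  second-codeList a b as = trans (cong first (π₂-pair a _)) (first-codeList b as)

  first-restrict-2^ : ∀ β x → first (restrict β (2 ^ x)) ≡ β x
  first-restrict-2^ β x = trans (cong (first ∘ codeList ∘ map β) (D-2^ x)) (first-codeList (β x) [])

  query : ℕ → ℕ → ℕ
  query x y = if does (x ≟ y) then 2 ^ x else if does (x <? y) then 2 ^ x + 2 ^ y else 2 ^ y + 2 ^ x

  answerˡ answerʳ : ℕ → ℕ → ℕ → ℕ
  answerˡ x y r = if does (y <? x) then second r else first r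
  answerʳ x y r = if does (x <? y) then second r else first r

  query-answers : ∀ β x y →
    length (D (query x y)) ≤ 2 ×
    answerˡ x y (restrict β (query x y)) ≡ β x × answerʳ x y (restrict β (query x y)) ≡ β y
  query-answers β x y with <-cmp x y
  ... | tri≈ x≮y refl _
    rewrite dec-true (x ≟ x) refl | dec-false (x <? x) x≮y | D-2^ x =
      s≤s z≤n , first-codeList (β x) [] , first-codeList (β x) []
  ... | tri< x<y x≢y y≮x
    rewrite dec-false (x ≟ y) x≢y | dec-true (x <? y) x<y | dec-false (y <? x) y≮x | D-2^+2^ x<y =
      ≤-refl , first-codeList (β x) (β y ∷ []) , second-codeList (β x) (β y) []
  ... | tri> x≮y x≢y y<x
    rewrite dec-false (x ≟ y) x≢y | dec-false (x <? y) x≮y | dec-true (y <? x) y<x | D-2^+2^ y<x =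
      ≤-refl , second-codeList (β y) (β x) [] , first-codeList (β y) (β x ∷ [])

  module _ {n : ℕ} where

    firstᶜ : ∀ {r} → Computable n r → Computable n (λ xs → first (r xs))
    firstᶜ cr = π₁ᶜ (predᶜ cr)

    secondᶜ : ∀ {r} → Computable n r → Computable n (λ xs → second (r xs))
    secondᶜ cr = firstᶜ (π₂ᶜ (predᶜ cr))

    queryᶜ : ∀ {x y} → Computable n x → Computable n y → Computable n (λ xs → query (x xs) (y xs))
    queryᶜ cx cy = ifᶜ cx ≡ᵇᶜ cy then 2^ᶜ cx
                   else ifᶜ cx <ᵇᶜ cy then 2^ᶜ cx +ᶜ 2^ᶜ cy else 2^ᶜ cy +ᶜ 2^ᶜ cx

    answerˡᶜ : ∀ {x y r} → Computable n x → Computable n y → Computable n r →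
               Computable n (λ xs → answerˡ (x xs) (y xs) (r xs))
    answerˡᶜ cx cy cr = ifᶜ cy <ᵇᶜ cx then secondᶜ cr else firstᶜ cr

    answerʳᶜ : ∀ {x y r} → Computable n x → Computable n y → Computable n r →
               Computable n (λ xs → answerʳ (x xs) (y xs) (r xs))
    answerʳᶜ cx cy cr = ifᶜ cx <ᵇᶜ cy then secondᶜ cr else firstᶜ cr

module Graph (g : ℕ → ℕ → ℕ) (f : ℕ → ℕ) (f≤g : ∀ x s → f x ≤ g x s)
             (attained : ∀ x → Σ ℕ λ s → g x s ≡ f x) where

  data Vertex : Set where
    hub tip : ℕ → Vertex
    arm     : ℕ → ℕ → ℕ → Vertex

  gadget : Vertex → ℕ
  gadget (hub x)     = x
  gadget (tip x)     = x
  gadget (arm x _ _) = x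

  data Edge : Vertex → Vertex → Set where
    hub-hub : ∀ x → Edge (hub x) (hub (suc x))
    hub-arm : ∀ x s → Edge (hub x) (arm x s 0)
    arm-arm : ∀ x s j → Edge (arm x s j) (arm x s (suc j))
    tip-arm : ∀ x s → Edge (tip x) (arm x s (g x s))

  Adjacent : Vertex → Vertex → Set
  Adjacent u v = Edge u v ⊎ Edge v u

  infixr 5 _∷_
  data Walk : Vertex → Vertex → ℕ → Set where
    []  : ∀ {u} → Walk u u 0
    _∷_ : ∀ {u w v n} → Adjacent u w → Walk w v n → Walk u v (suc n)

  span : ℕ → ℕ
  span x = 2 + f x

  fromHubWith fromTipWith : ℕ → Vertex → ℕ
  fromHubWith F (hub _)     = 0
  fromHubWith F (tip _)     = F
  fromHubWith F (arm x s j) = suc j ⊓ (∣ j - g x s ∣ + suc F)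
  fromTipWith F (hub _)     = F
  fromTipWith F (tip _)     = 0
  fromTipWith F (arm x s j) = suc ∣ j - g x s ∣ ⊓ (suc j + F)

  -- d is returned when u and v lie on no common arm; it is the default viaHubs in distWith, so it
  -- does not affect the minimum there.
  alongArm : Vertex → Vertex → ℕ → ℕ
  alongArm (arm _ s j) (arm _ t k) d = if does (s ≟ t) then ∣ j - k ∣ else d
  alongArm (arm _ _ _) (hub _)     d = d
  alongArm (arm _ _ _) (tip _)     d = d
  alongArm (hub _)     _           d = d
  alongArm (tip _)     _           d = d

  -- Fu and Fv stand for span (gadget u) and span (gadget v), so that distWith can be evaluated from
  -- two values of f.
  viaHubsWith viaTipsWith distWith : ℕ → ℕ → Vertex → Vertex → ℕ
  viaHubsWith Fu Fv u v = fromHubWith Fu u + ∣ gadget u - gadget v ∣ + fromHubWith Fv v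
  viaTipsWith Fu Fv u v = fromTipWith Fu u + fromTipWith Fv v
  distWith Fu Fv u v =
    if does (gadget u ≟ gadget v)
    then (viaHubsWith Fu Fv u v ⊓ viaTipsWith Fu Fv u v) ⊓ alongArm u v (viaHubsWith Fu Fv u v)
    else viaHubsWith Fu Fv u v

  fromHub fromTip : Vertex → ℕ
  fromHub v = fromHubWith (span (gadget v)) v
  fromTip v = fromTipWith (span (gadget v)) v

  viaHubs viaTips dist : Vertex → Vertex → ℕ
  viaHubs u v = viaHubsWith (span (gadget u)) (span (gadget v)) u v
  viaTips u v = viaTipsWith (span (gadget u)) (span (gadget v)) u v
  dist    u v = distWith    (span (gadget u)) (span (gadget v)) u v

  dist-same-gadget : ∀ u v → gadget u ≡ gadget v →
    dist u v ≡ (viaHubs u v ⊓ viaTips u v) ⊓ alongArm u v (viaHubs u v)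
  dist-same-gadget u v eq rewrite dec-true (gadget u ≟ gadget v) eq = refl

  dist-other-gadget : ∀ u v → ¬ gadget u ≡ gadget v → dist u v ≡ viaHubs u v
  dist-other-gadget u v neq rewrite dec-false (gadget u ≟ gadget v) neq = refl

  dist≤viaHubs : ∀ u v → dist u v ≤ viaHubs u v
  dist≤viaHubs u v with gadget u ≟ gadget v
  ... | yes eq  = ≤-trans (≤-reflexive (dist-same-gadget u v eq)) (≤-trans (m⊓n≤m _ _) (m⊓n≤m _ _))
  ... | no  neq = ≤-reflexive (dist-other-gadget u v neq)

  dist≤viaTips : ∀ u v → gadget u ≡ gadget v → dist u v ≤ viaTips u v
  dist≤viaTips u v eq = ≤-trans (≤-reflexive (dist-same-gadget u v eq)) (≤-trans (m⊓n≤m _ _) (m⊓n≤n _ _))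

  dist≤alongArm : ∀ x s j k → dist (arm x s j) (arm x s k) ≤ ∣ j - k ∣
  dist≤alongArm x s j k rewrite dec-true (x ≟ x) refl | dec-true (s ≟ s) refl = m⊓n≤n _ _

  dist-self : ∀ u → dist u u ≤ 0
  dist-self (hub x)     = ≤-trans (dist≤viaHubs (hub x) (hub x)) (≤-reflexive (cong (_+ 0) (∣n-n∣≡0 x)))
  dist-self (tip x)     = dist≤viaTips (tip x) (tip x) refl
  dist-self (arm x s j) = ≤-trans (dist≤alongArm x s j j) (≤-reflexive (∣n-n∣≡0 j))

  dist-hub-tip : ∀ x → dist (hub x) (tip x) ≡ span x
  dist-hub-tip x = begin
    dist (hub x) (tip x)                               ≡⟨ dist-same-gadget (hub x) (tip x) refl ⟩
    (viaHubs (hub x) (tip x) ⊓ viaTips (hub x) (tip x)) ⊓ viaHubs (hub x) (tip x)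
      ≡⟨ cong₂ (λ a b → (a ⊓ b) ⊓ a) (cong (_+ span x) (∣n-n∣≡0 x)) (+-identityʳ (span x)) ⟩
    (span x ⊓ span x) ⊓ span x                         ≡⟨ cong (_⊓ span x) (⊓-idem (span x)) ⟩
    span x ⊓ span x                                    ≡⟨ ⊓-idem (span x) ⟩
    span x                                             ∎
    where open ≡-Reasoning

  data DistCase (u v : Vertex) : Set where
    via-hubs  : dist u v ≡ viaHubs u v → DistCase u v
    via-tips  : gadget u ≡ gadget v → dist u v ≡ viaTips u v → DistCase u v
    along-arm : ∀ {x s j k} → u ≡ arm x s j → v ≡ arm x s k → dist u v ≡ ∣ j - k ∣ → DistCase u v

  alongArm-cases : ∀ u v d → gadget u ≡ gadget v →
    alongArm u v d ≡ d ⊎ Σ ℕ λ x → Σ ℕ λ s → Σ ℕ λ j → Σ ℕ λ k →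
                            u ≡ arm x s j × v ≡ arm x s k × alongArm u v d ≡ ∣ j - k ∣
  alongArm-cases (arm x s j) (arm .x t k) d refl with s ≟ t
  ... | yes refl = inj₂ (x , s , j , k , refl , refl , cong (if_then ∣ j - k ∣ else d) (dec-true (s ≟ s) refl))
  ... | no  s≢t  = inj₁ (cong (if_then ∣ j - k ∣ else d) (dec-false (s ≟ t) s≢t))
  alongArm-cases (arm _ _ _) (hub _) d _ = inj₁ refl
  alongArm-cases (arm _ _ _) (tip _) d _ = inj₁ refl
  alongArm-cases (hub _)     _       d _ = inj₁ refl
  alongArm-cases (tip _)     _       d _ = inj₁ refl

  distCase : ∀ u v → DistCase u v
  distCase u v with gadget u ≟ gadget v
  ... | no neq = via-hubs (dist-other-gadget u v neq)
  ... | yes eq with ⊓-sel (viaHubs u v ⊓ viaTips u v) (alongArm u v (viaHubs u v))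
                  | ⊓-sel (viaHubs u v) (viaTips u v)
                  | alongArm-cases u v (viaHubs u v) eq
  ...   | inj₁ min₁ | inj₁ min₂ | _ = via-hubs (trans (dist-same-gadget u v eq) (trans min₁ min₂))
  ...   | inj₁ min₁ | inj₂ min₂ | _ = via-tips eq (trans (dist-same-gadget u v eq) (trans min₁ min₂))
  ...   | inj₂ min₁ | _ | inj₁ arm≡d = via-hubs (trans (dist-same-gadget u v eq) (trans min₁ arm≡d))
  ...   | inj₂ min₁ | _ | inj₂ (_ , _ , _ , _ , refl , refl , arm≡) =
    along-arm refl refl (trans (dist-same-gadget u v eq) (trans min₁ arm≡))

  private
    ∣n-1+n∣≡1 : ∀ n → ∣ n - suc n ∣ ≡ 1
    ∣n-1+n∣≡1 zero    = refl
    ∣n-1+n∣≡1 (suc n) = ∣n-1+n∣≡1 n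

    ∣m-o∣≤1+∣n-o∣ : ∀ {m n} o → ∣ m - n ∣ ≡ 1 → ∣ m - o ∣ ≤ suc ∣ n - o ∣
    ∣m-o∣≤1+∣n-o∣ {m} {n} o m~n = ≤-trans (∣-∣-triangle m n o) (≤-reflexive (cong (_+ ∣ n - o ∣) m~n))

    ∣n-o∣≤1+∣1+n-o∣ : ∀ n o → ∣ n - o ∣ ≤ suc ∣ suc n - o ∣
    ∣n-o∣≤1+∣1+n-o∣ n o = ∣m-o∣≤1+∣n-o∣ {n} {suc n} o (∣n-1+n∣≡1 n)

    ∣1+n-o∣≤1+∣n-o∣ : ∀ n o → ∣ suc n - o ∣ ≤ suc ∣ n - o ∣
    ∣1+n-o∣≤1+∣n-o∣ n o = ∣m-o∣≤1+∣n-o∣ {suc n} {n} o (trans (∣-∣-comm (suc n) n) (∣n-1+n∣≡1 n))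

    span≤2+g : ∀ x s → span x ≤ 2 + g x s
    span≤2+g x s = s≤s (s≤s (f≤g x s))

  fromHub≤span+fromTip : ∀ v → fromHub v ≤ span (gadget v) + fromTip v
  fromHub≤span+fromTip (hub x)     = z≤n
  fromHub≤span+fromTip (tip x)     = m≤m+n _ _
  fromHub≤span+fromTip (arm x s j) with ⊓-sel (suc ∣ j - g x s ∣) (suc j + span x)
  ... | inj₁ eq = ≤-trans (m⊓n≤n _ _) (≤-reflexive (begin
    ∣ j - g x s ∣ + suc (span x)   ≡⟨ +-suc _ (span x) ⟩
    suc (∣ j - g x s ∣ + span x)   ≡⟨ cong suc (+-comm ∣ j - g x s ∣ (span x)) ⟩
    suc (span x + ∣ j - g x s ∣)   ≡⟨ +-suc (span x) _ ⟨
    span x + suc ∣ j - g x s ∣     ≡⟨ cong (span x +_) eq ⟨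
    span x + fromTip (arm x s j)   ∎))
    where open ≡-Reasoning
  ... | inj₂ eq = ≤-trans (m⊓n≤m _ _)
    (≤-trans (m≤m+n (suc j) (span x)) (≤-trans (m≤n+m _ (span x)) (≤-reflexive (cong (span x +_) (sym eq)))))

  lipschitz-within : ∀ {x z} → gadget x ≡ gadget z →
    fromHub x ≤ suc (fromHub z) → fromTip x ≤ suc (fromTip z) →
    (∀ {y s j k} → z ≡ arm y s j → dist x (arm y s k) ≤ suc ∣ j - k ∣) →
    ∀ v → dist x v ≤ suc (dist z v)
  lipschitz-within {x} {z} x~z hub≤ tip≤ along≤ v with distCase z v
  ... | via-hubs d≡ = ≤-trans (dist≤viaHubs x v)
    (≤-trans (+-monoˡ-≤ (fromHub v) (+-mono-≤ hub≤ (≤-reflexive (cong (λ t → ∣ t - gadget v ∣) x~z))))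
             (≤-reflexive (cong suc (sym d≡))))
  ... | via-tips z~v d≡ = ≤-trans (dist≤viaTips x v (trans x~z z~v))
    (≤-trans (+-monoˡ-≤ (fromTip v) tip≤) (≤-reflexive (cong suc (sym d≡))))
  ... | along-arm refl refl d≡ = ≤-trans (along≤ refl) (≤-reflexive (cong suc (sym d≡)))

  lipschitz-hubs : ∀ x x′ → (∀ y → ∣ x - y ∣ ≤ suc ∣ x′ - y ∣) →
    ∀ v → dist (hub x) v ≤ suc (dist (hub x′) v)
  lipschitz-hubs x x′ step v with distCase (hub x′) v
  ... | via-hubs d≡ = ≤-trans (dist≤viaHubs (hub x) v)
    (≤-trans (+-monoˡ-≤ (fromHub v) (step (gadget v))) (≤-reflexive (cong suc (sym d≡))))
  ... | via-tips refl d≡ = ≤-trans (dist≤viaHubs (hub x) v)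
    (≤-trans (+-mono-≤ (≤-trans (step x′) (≤-reflexive (cong suc (∣n-n∣≡0 x′))))
                       (fromHub≤span+fromTip v))
             (≤-reflexive (cong suc (sym d≡))))
  ... | along-arm () _ _

  dist-lipschitz : ∀ {x z} → Adjacent x z → ∀ v → dist x v ≤ suc (dist z v)
  dist-lipschitz (inj₁ (hub-hub x)) = lipschitz-hubs x (suc x) (∣n-o∣≤1+∣1+n-o∣ x)
  dist-lipschitz (inj₂ (hub-hub x)) = lipschitz-hubs (suc x) x (∣1+n-o∣≤1+∣n-o∣ x)
  dist-lipschitz (inj₁ (hub-arm x s)) = lipschitz-within {hub x} {arm x s 0} refl z≤n
    (⊓-glb (span≤2+g x s) (≤-trans (n≤1+n _) (n≤1+n _)))
    (λ { {k = k} refl → ≤-trans (dist≤viaHubs (hub x) (arm x s k))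
           (≤-trans (≤-reflexive (cong (_+ fromHub (arm x s k)) (∣n-n∣≡0 x))) (m⊓n≤m _ _)) })
  dist-lipschitz (inj₂ (hub-arm x s)) = lipschitz-within {arm x s 0} {hub x} refl
    (m⊓n≤m _ _) (m⊓n≤n _ _) (λ ())
  dist-lipschitz (inj₁ (arm-arm x s j)) = lipschitz-within {arm x s j} {arm x s (suc j)} refl
    (⊓-mono-≤ (≤-trans (n≤1+n _) (n≤1+n _)) (+-monoˡ-≤ (suc (span x)) (∣n-o∣≤1+∣1+n-o∣ j (g x s))))
    (⊓-mono-≤ (s≤s (∣n-o∣≤1+∣1+n-o∣ j (g x s))) (≤-trans (n≤1+n _) (n≤1+n _)))
    (λ { {k = k} refl → ≤-trans (dist≤alongArm x s j k) (∣n-o∣≤1+∣1+n-o∣ j k) })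
  dist-lipschitz (inj₂ (arm-arm x s j)) = lipschitz-within {arm x s (suc j)} {arm x s j} refl
    (⊓-mono-≤ ≤-refl (+-monoˡ-≤ (suc (span x)) (∣1+n-o∣≤1+∣n-o∣ j (g x s))))
    (⊓-mono-≤ (s≤s (∣1+n-o∣≤1+∣n-o∣ j (g x s))) ≤-refl)
    (λ { {k = k} refl → ≤-trans (dist≤alongArm x s (suc j) k) (∣1+n-o∣≤1+∣n-o∣ j k) })
  dist-lipschitz (inj₁ (tip-arm x s)) = lipschitz-within {tip x} {arm x s (g x s)} refl
    (⊓-glb (span≤2+g x s) (≤-trans (≤-trans (n≤1+n (span x)) (n≤1+n _)) (s≤s (m≤n+m (suc (span x)) _))))
    z≤n
    (λ { {k = k} refl → ≤-trans (dist≤viaTips (tip x) (arm x s k) refl)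
           (≤-trans (m⊓n≤m _ _) (≤-reflexive (cong suc (∣-∣-comm k (g x s))))) })
  dist-lipschitz (inj₂ (tip-arm x s)) = lipschitz-within {arm x s (g x s)} {tip x} refl
    (≤-trans (m⊓n≤n _ _) (≤-reflexive (cong (_+ suc (span x)) (∣n-n∣≡0 (g x s)))))
    (≤-trans (m⊓n≤m _ _) (≤-reflexive (cong suc (∣n-n∣≡0 (g x s)))))
    (λ ())

  dist≤length : ∀ {u v n} → Walk u v n → dist u v ≤ n
  dist≤length {u}     []       = dist-self u
  dist≤length {v = v} (e ∷ es) = ≤-trans (dist-lipschitz e v) (s≤s (dist≤length es))

  cast : ∀ {u v m n} → m ≡ n → Walk u v m → Walk u v n
  cast refl w = w

  infixr 5 _++_
  _++_ : ∀ {u v w m n} → Walk u v m → Walk v w n → Walk u w (m + n)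
  []       ++ w′ = w′
  (e ∷ es) ++ w′ = e ∷ (es ++ w′)

  reverse : ∀ {u v n} → Walk u v n → Walk v u n
  reverse []                 = []
  reverse (_∷_ {n = n} e es) = cast (+-comm n 1) (reverse es ++ swap e ∷ [])

  path-walk : (p : ℕ → Vertex) → (∀ j → Edge (p j) (p (suc j))) → ∀ j k → Walk (p j) (p k) ∣ j - k ∣
  path-walk p step zero    k       = upward p step k
    where
    upward : (p : ℕ → Vertex) → (∀ j → Edge (p j) (p (suc j))) → ∀ k → Walk (p 0) (p k) k
    upward p step zero    = []
    upward p step (suc k) = inj₁ (step 0) ∷ upward (p ∘ suc) (step ∘ suc) k
  path-walk p step (suc j) zero    = reverse (path-walk p step 0 (suc j))
  path-walk p step (suc j) (suc k) = path-walk (p ∘ suc) (step ∘ suc) j k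

  hub→arm : ∀ x s j → Walk (hub x) (arm x s j) (suc j)
  hub→arm x s j = inj₁ (hub-arm x s) ∷ path-walk (arm x s) (arm-arm x s) 0 j

  tip→arm : ∀ x s j → Walk (tip x) (arm x s j) (suc ∣ j - g x s ∣)
  tip→arm x s j = inj₁ (tip-arm x s) ∷
    cast (∣-∣-comm (g x s) j) (path-walk (arm x s) (arm-arm x s) (g x s) j)

  hub→tip : ∀ x → Walk (hub x) (tip x) (span x)
  hub→tip x = cast (cong (2 +_) g≡f)
    (cast (+-comm (suc (g x s)) 1) (hub→arm x s (g x s) ++ inj₂ (tip-arm x s) ∷ []))
    where
    s   = proj₁ (attained x)
    g≡f = proj₂ (attained x)

  fromHub-walk : ∀ v → Walk (hub (gadget v)) v (fromHub v)
  fromHub-walk (hub x)     = []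
  fromHub-walk (tip x)     = hub→tip x
  fromHub-walk (arm x s j) with ⊓-sel (suc j) (∣ j - g x s ∣ + suc (span x))
  ... | inj₁ eq = cast (sym eq) (hub→arm x s j)
  ... | inj₂ eq = cast (trans (trans (+-suc (span x) _) (cong suc (+-comm (span x) _)))
                              (trans (sym (+-suc _ (span x))) (sym eq)))
                       (hub→tip x ++ tip→arm x s j)

  fromTip-walk : ∀ v → Walk (tip (gadget v)) v (fromTip v)
  fromTip-walk (hub x)     = reverse (hub→tip x)
  fromTip-walk (tip x)     = []
  fromTip-walk (arm x s j) with ⊓-sel (suc ∣ j - g x s ∣) (suc j + span x)
  ... | inj₁ eq = cast (sym eq) (tip→arm x s j)
  ... | inj₂ eq = cast (trans (+-comm (span x) (suc j)) (sym eq)) (reverse (hub→tip x) ++ hub→arm x s j)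

  dist-walk : ∀ u v → Walk u v (dist u v)
  dist-walk u v with distCase u v
  ... | via-hubs d≡ = cast (sym d≡)
    ((reverse (fromHub-walk u) ++ path-walk hub hub-hub (gadget u) (gadget v)) ++ fromHub-walk v)
  ... | via-tips u~v d≡ = cast (sym d≡)
    (subst (λ x → Walk u (tip x) (fromTip u)) u~v (reverse (fromTip-walk u)) ++ fromTip-walk v)
  ... | along-arm {x} {s} {j} {k} refl refl d≡ = cast (sym d≡) (path-walk (arm x s) (arm-arm x s) j k)

module Coding (g : ℕ → ℕ → ℕ) (f : ℕ → ℕ) (f≤g : ∀ x s → f x ≤ g x s)
              (attained : ∀ x → Σ ℕ λ s → g x s ≡ f x) where

  open Computability
  open Pairing
  open Graph g f f≤g attained

  encode : Vertex → ℕ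
  encode (hub x)     = ⟨ x , 0 ⟩
  encode (tip x)     = ⟨ x , 1 ⟩
  encode (arm x s j) = ⟨ x , 2 + ⟨ s , j ⟩ ⟩

  decodeWith : ℕ → ℕ → Vertex
  decodeWith x 0             = hub x
  decodeWith x 1             = tip x
  decodeWith x (suc (suc k)) = arm x (π₁ k) (π₂ k)

  decode : ℕ → Vertex
  decode n = decodeWith (π₁ n) (π₂ n)

  decode-encode : ∀ v → decode (encode v) ≡ v
  decode-encode (hub x)     rewrite π₁-pair x 0 | π₂-pair x 0 = refl
  decode-encode (tip x)     rewrite π₁-pair x 1 | π₂-pair x 1 = refl
  decode-encode (arm x s j) rewrite π₁-pair x (2 + ⟨ s , j ⟩) | π₂-pair x (2 + ⟨ s , j ⟩)
                                  | π₁-pair s j | π₂-pair s j = refl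

  encode-decode : ∀ n → encode (decode n) ≡ n
  encode-decode n = trans (encode-decodeWith (π₁ n) (π₂ n)) (pair-unpair n)
    where
    encode-decodeWith : ∀ x k → encode (decodeWith x k) ≡ ⟨ x , k ⟩
    encode-decodeWith x 0             = refl
    encode-decodeWith x 1             = refl
    encode-decodeWith x (suc (suc k)) = cong (λ k → ⟨ x , 2 + k ⟩) (pair-unpair k)

  edge? : Vertex → Vertex → Bool
  edge? (hub x)     (hub y)     = does (y ≟ suc x)
  edge? (hub x)     (arm y _ j) = does (x ≟ y) ∧ does (j ≟ 0)
  edge? (arm x s j) (arm y t k) = does (x ≟ y) ∧ does (s ≟ t) ∧ does (k ≟ suc j)
  edge? (tip x)     (arm y s j) = does (x ≟ y) ∧ does (j ≟ g x s)
  edge? (hub _)     (tip _)     = false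
  edge? (arm _ _ _) (hub _)     = false
  edge? (arm _ _ _) (tip _)     = false
  edge? (tip _)     (hub _)     = false
  edge? (tip _)     (tip _)     = false

  adjacent? : Vertex → Vertex → Bool
  adjacent? u v = edge? u v ∨ edge? v u

  private
    ≟-sound : ∀ {m n} → does (m ≟ n) ≡ true → m ≡ n
    ≟-sound {m} {n} eq = ≡ᵇ⇒≡ m n (subst T (sym eq) _)

    ≟-refl : ∀ n → does (n ≟ n) ≡ true
    ≟-refl n = dec-true (n ≟ n) refl

  edge?-sound : ∀ u v → edge? u v ≡ true → Edge u v
  edge?-sound (hub x) (hub y) e with refl ← ≟-sound {y} {suc x} e = hub-hub x
  edge?-sound (hub x) (arm y s j) e
    with refl ← ≟-sound {x} {y} (∧-conicalˡ _ _ e)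
       | refl ← ≟-sound {j} {0} (∧-conicalʳ _ _ e) = hub-arm x s
  edge?-sound (arm x s j) (arm y t k) e
    with refl ← ≟-sound {x} {y} (∧-conicalˡ _ _ e)
       | refl ← ≟-sound {s} {t} (∧-conicalˡ _ _ (∧-conicalʳ (does (x ≟ y)) _ e))
       | refl ← ≟-sound {k} {suc j} (∧-conicalʳ (does (s ≟ t)) _ (∧-conicalʳ (does (x ≟ y)) _ e))
       = arm-arm x s j
  edge?-sound (tip x) (arm y s j) e
    with refl ← ≟-sound {x} {y} (∧-conicalˡ _ _ e)
       | refl ← ≟-sound {j} {g x s} (∧-conicalʳ _ _ e) = tip-arm x s

  edge?-complete : ∀ {u v} → Edge u v → edge? u v ≡ true
  edge?-complete (hub-hub x)     = ≟-refl (suc x)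
  edge?-complete (hub-arm x s)   = cong₂ _∧_ (≟-refl x) (≟-refl 0)
  edge?-complete (arm-arm x s j) = cong₂ _∧_ (≟-refl x) (cong₂ _∧_ (≟-refl s) (≟-refl (suc j)))
  edge?-complete (tip-arm x s)   = cong₂ _∧_ (≟-refl x) (≟-refl (g x s))

  adjacent?-sound : ∀ u v → adjacent? u v ≡ true → Adjacent u v
  adjacent?-sound u v e with edge? u v in uv | edge? v u in vu
  adjacent?-sound u v e  | true  | _     = inj₁ (edge?-sound u v uv)
  adjacent?-sound u v e  | false | true  = inj₂ (edge?-sound v u vu)
  adjacent?-sound u v () | false | false

  adjacent?-complete : ∀ {u v} → Adjacent u v → adjacent? u v ≡ true
  adjacent?-complete {u} {v} (inj₁ e) = cong (_∨ edge? v u) (edge?-complete e)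
  adjacent?-complete {u} {v} (inj₂ e) =
    trans (cong (edge? u v ∨_) (edge?-complete e)) (∨-comm (edge? u v) true)

  edge?-irreflexive : ∀ v → edge? v v ≡ false
  edge?-irreflexive (hub x)     = dec-false (x ≟ suc x) (1+n≢n ∘ sym)
  edge?-irreflexive (tip x)     = refl
  edge?-irreflexive (arm x s j) rewrite ≟-refl x | ≟-refl s = dec-false (j ≟ suc j) (1+n≢n ∘ sym)

  adjacent?-irreflexive : ∀ v → adjacent? v v ≡ false
  adjacent?-irreflexive v rewrite edge?-irreflexive v = refl

  module _ {n : ℕ} where

    decodeᶜ : (φ : Vec ℕ n → Vertex → ℕ) → ∀ {u} → Computable n u →
      (∀ {x} → Computable n x → Computable n (λ xs → φ xs (hub (x xs)))) →
      (∀ {x} → Computable n x → Computable n (λ xs → φ xs (tip (x xs)))) →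
      (∀ {x s j} → Computable n x → Computable n s → Computable n j →
                   Computable n (λ xs → φ xs (arm (x xs) (s xs) (j xs)))) →
      Computable n (λ xs → φ xs (decode (u xs)))
    decodeᶜ φ {u} cu hubᶜ tipᶜ armᶜ = respᶜ (λ xs → by-kind (φ xs) (π₁ (u xs)) (π₂ (u xs)))
      (ifᶜ π₂ᶜ cu ≡ᵇᶜ constᶜ 0 then hubᶜ (π₁ᶜ cu)
       else ifᶜ π₂ᶜ cu ≡ᵇᶜ constᶜ 1 then tipᶜ (π₁ᶜ cu)
       else armᶜ (π₁ᶜ cu) (π₁ᶜ (π₂ᶜ cu ∸ᶜ constᶜ 2)) (π₂ᶜ (π₂ᶜ cu ∸ᶜ constᶜ 2)))
      where
      by-kind : (ψ : Vertex → ℕ) → ∀ x k →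
        (if k ≡ᵇ 0 then ψ (hub x)
         else if k ≡ᵇ 1 then ψ (tip x)
         else ψ (arm x (π₁ (k ∸ 2)) (π₂ (k ∸ 2))))
          ≡ ψ (decodeWith x k)
      by-kind ψ x 0             = refl
      by-kind ψ x 1             = refl
      by-kind ψ x (suc (suc k)) = refl

    gadgetᶜ : ∀ {w} → Computable n w → Computable n (λ xs → gadget (decode (w xs)))
    gadgetᶜ cw = decodeᶜ (λ _ → gadget) cw id id (λ cx _ _ → cx)

  module _ (g-computable : Computable₂ g) {n : ℕ} where

    gᶜ : ∀ {x s} → Computable n x → Computable n s → Computable n (λ xs → g (x xs) (s xs))
    gᶜ = lift₂ {h = g} (fromComputable₂ g-computable)

    adjacent?ᶜ : ∀ {u v} → Computable n u → Computable n v →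
                 ComputablePred n (λ xs → adjacent? (decode (u xs)) (decode (v xs)))
    adjacent?ᶜ cu cv = edge?ᶜ cu cv ∨ᶜ edge?ᶜ cv cu
      where
      edge?ᶜ : ∀ {u v} → Computable n u → Computable n v →
               ComputablePred n (λ xs → edge? (decode (u xs)) (decode (v xs)))
      edge?ᶜ {u} {v} cu cv = decodeᶜ (λ xs w → indicator (edge? w (decode (v xs)))) cu
        (λ {x} cx → decodeᶜ (λ xs w → indicator (edge? (hub (x xs)) w)) cv
           (λ cy → cy ≡ᵇᶜ sucᶜ cx) (λ _ → constᶜ 0)
           (λ cy _ cj → cx ≡ᵇᶜ cy ∧ᶜ cj ≡ᵇᶜ constᶜ 0))
        (λ {x} cx → decodeᶜ (λ xs w → indicator (edge? (tip (x xs)) w)) cv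
           (λ _ → constᶜ 0) (λ _ → constᶜ 0) (λ cy cs cj → cx ≡ᵇᶜ cy ∧ᶜ cj ≡ᵇᶜ gᶜ cx cs))
        (λ {x} {s} {j} cx cs cj → decodeᶜ (λ xs w → indicator (edge? (arm (x xs) (s xs) (j xs)) w)) cv
           (λ _ → constᶜ 0) (λ _ → constᶜ 0)
           (λ cy ct ck → cx ≡ᵇᶜ cy ∧ᶜ cs ≡ᵇᶜ ct ∧ᶜ ck ≡ᵇᶜ sucᶜ cj))

    distWithᶜ : ∀ {Fu Fv u v} → Computable n Fu → Computable n Fv → Computable n u → Computable n v →
      Computable n (λ xs → distWith (Fu xs) (Fv xs) (decode (u xs)) (decode (v xs)))
    distWithᶜ {Fu} {Fv} {u} {v} cFu cFv cu cv =
      ifᶜ gadgetᶜ cu ≡ᵇᶜ gadgetᶜ cv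
      then (viaHubsᶜ ⊓ᶜ viaTipsᶜ) ⊓ᶜ alongArmᶜ viaHubsᶜ
      else viaHubsᶜ
      where
      fromHubWithᶜ : ∀ {F w} → Computable n F → Computable n w →
        Computable n (λ xs → fromHubWith (F xs) (decode (w xs)))
      fromHubWithᶜ {F} cF cw = decodeᶜ (λ xs → fromHubWith (F xs)) cw (λ _ → constᶜ 0) (λ _ → cF)
        (λ cx cs cj → sucᶜ cj ⊓ᶜ (∣ cj -ᶜ gᶜ cx cs ∣ +ᶜ sucᶜ cF))

      fromTipWithᶜ : ∀ {F w} → Computable n F → Computable n w →
        Computable n (λ xs → fromTipWith (F xs) (decode (w xs)))
      fromTipWithᶜ {F} cF cw = decodeᶜ (λ xs → fromTipWith (F xs)) cw (λ _ → cF) (λ _ → constᶜ 0)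
        (λ cx cs cj → sucᶜ ∣ cj -ᶜ gᶜ cx cs ∣ ⊓ᶜ (sucᶜ cj +ᶜ cF))

      viaHubsᶜ : Computable n (λ xs → viaHubsWith (Fu xs) (Fv xs) (decode (u xs)) (decode (v xs)))
      viaHubsᶜ = fromHubWithᶜ cFu cu +ᶜ ∣ gadgetᶜ cu -ᶜ gadgetᶜ cv ∣ +ᶜ fromHubWithᶜ cFv cv

      viaTipsᶜ : Computable n (λ xs → viaTipsWith (Fu xs) (Fv xs) (decode (u xs)) (decode (v xs)))
      viaTipsᶜ = fromTipWithᶜ cFu cu +ᶜ fromTipWithᶜ cFv cv

      alongArmᶜ : ∀ {d} → Computable n d → Computable n (λ xs → alongArm (decode (u xs)) (decode (v xs)) (d xs))
      alongArmᶜ {d} cd = decodeᶜ (λ xs w → alongArm w (decode (v xs)) (d xs)) cu (λ _ → cd) (λ _ → cd)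
        (λ {x} {s} {j} cx cs cj → decodeᶜ (λ xs w → alongArm (arm (x xs) (s xs) (j xs)) w (d xs)) cv
           (λ _ → cd) (λ _ → cd) (λ _ ct ck → ifᶜ cs ≡ᵇᶜ ct then ∣ cj -ᶜ ck ∣ else cd))

h[s+k]≤h[s] : ∀ (h : ℕ → ℕ) → (∀ s → h (suc s) ≤ h s) → ∀ s k → h (s + k) ≤ h s
h[s+k]≤h[s] h step s zero    = ≤-reflexive (cong h (+-identityʳ s))
h[s+k]≤h[s] h step s (suc k) =
  ≤-trans (≤-reflexive (cong h (+-suc s k))) (≤-trans (step (s + k)) (h[s+k]≤h[s] h step s k))

module Construction (f : ℕ → ℕ) (g : ℕ → ℕ → ℕ) (g-computable : Computable₂ g)
  (antitone : ∀ x s → g x (suc s) ≤ g x s)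
  (limit : ∀ x → Σ ℕ λ s₀ → ∀ s → s₀ ≤ s → g x s ≡ f x) where

  open Computability
  open Pairing
  open CanonicalSets
  open Queries

  f≤g : ∀ x s → f x ≤ g x s
  f≤g x s = ≤-trans (≤-reflexive (sym (proj₂ (limit x) (s + s₀) (m≤n+m s₀ s))))
                    (h[s+k]≤h[s] (g x) (antitone x) s s₀)
    where s₀ = proj₁ (limit x)

  attained : ∀ x → Σ ℕ λ s → g x s ≡ f x
  attained x = proj₁ (limit x) , proj₂ (limit x) (proj₁ (limit x)) ≤-refl

  module G = Graph g f f≤g attained
  open G using (hub; tip; dist; span; gadget; distWith; dist≤length; dist-walk; dist-hub-tip)
  open Coding g f f≤g attained

  graph : CompGraph
  graph = record
    { bound  = nothing
    ; E      = λ x y → adjacent? (decode x) (decode y)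
    ; E-comp = computable₂ (adjacent?ᶜ g-computable var₀ var₁)
    ; E-sym  = λ x y → ∨-comm (edge? (decode x) (decode y)) _
    ; E-irr  = λ x → adjacent?-irreflexive (decode x)
    }

  open CompGraph graph

  toWalk : ∀ {u v n} → G.Walk u v n → Walk (encode u) (encode v) n
  toWalk G.[] = w-nil tt
  toWalk {u} (G._∷_ {w = w} a as) =
    w-cons tt (trans (cong₂ adjacent? (decode-encode u) (decode-encode w)) (adjacent?-complete a)) (toWalk as)

  fromWalk : ∀ {x y n} → Walk x y n → G.Walk (decode x) (decode y) n
  fromWalk (w-nil _)                    = G.[]
  fromWalk (w-cons {x} {z} _ adj walk) = adjacent?-sound (decode x) (decode z) adj G.∷ fromWalk walk

  shortest-walk : ∀ x y → Walk x y (dist (decode x) (decode y))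
  shortest-walk x y = subst₂ (λ a b → Walk a b (dist (decode x) (decode y)))
                             (encode-decode x) (encode-decode y) (toWalk (dist-walk (decode x) (decode y)))

  connected : Connected
  connected x y _ _ = _ , shortest-walk x y

  d : ℕ → ℕ
  d n = dist (decode (π₁ n)) (decode (π₂ n))

  d-pair : ∀ x y → d ⟨ x , y ⟩ ≡ dist (decode x) (decode y)
  d-pair x y = cong₂ (λ a b → dist (decode a) (decode b)) (π₁-pair x y) (π₂-pair x y)

  d-isDistance : IsDistance d
  d-isDistance = (λ x y _ _ → subst (Walk x y) (sym (d-pair x y)) (shortest-walk x y) ,
                              λ m walk → subst (_≤ m) (sym (d-pair x y)) (dist≤length (fromWalk walk)))
               , λ x y ¬dom → ⊥-elim (¬dom (tt , tt))

  hub-tip : ℕ → ℕ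
  hub-tip x = ⟨ encode (hub x) , encode (tip x) ⟩

  d-hub-tip : ∀ x → d (hub-tip x) ≡ span x
  d-hub-tip x = begin
    d (hub-tip x)                                            ≡⟨ d-pair (encode (hub x)) (encode (tip x)) ⟩
    dist (decode (encode (hub x))) (decode (encode (tip x)))
      ≡⟨ cong₂ dist (decode-encode (hub x)) (decode-encode (tip x)) ⟩
    dist (hub x) (tip x)                                     ≡⟨ dist-hub-tip x ⟩
    span x                                                   ∎
    where open ≡-Reasoning

  f≤d : f ≤[ 2 ]btt d
  f≤d = (λ x → 2 ^ hub-tip x) , (λ _ r → first r ∸ 2) ,
        computable₁ (2^ᶜ ⟨ ⟨ var₀ ,ᶜ constᶜ 0 ⟩ ,ᶜ ⟨ var₀ ,ᶜ constᶜ 1 ⟩ ⟩) ,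
        computable₂ (firstᶜ var₁ ∸ᶜ constᶜ 2) ,
        λ x → subst (λ l → length l ≤ 2) (sym (D-2^ (hub-tip x))) (s≤s z≤n) ,
              sym (cong (_∸ 2) (trans (first-restrict-2^ d (hub-tip x)) (d-hub-tip x)))

  d≤f : d ≤[ 2 ]btt f
  d≤f = (λ n → query (x₁ n) (x₂ n)) , q , computable₁ (queryᶜ x₁ᶜ x₂ᶜ) , computable₂ qᶜ ,
        λ n → let (length≤2 , answerˡ≡ , answerʳ≡) = query-answers f (x₁ n) (x₂ n) in
              length≤2 , sym (cong₂ (λ a b → distWith (2 + a) (2 + b) (u n) (v n)) answerˡ≡ answerʳ≡)
    where
    u v : ℕ → G.Vertex
    u n = decode (π₁ n)
    v n = decode (π₂ n)

    x₁ x₂ : ℕ → ℕ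
    x₁ n = gadget (u n)
    x₂ n = gadget (v n)

    x₁ᶜ : ∀ {m} → Computable (suc m) (λ xs → x₁ (head xs))
    x₁ᶜ = gadgetᶜ (π₁ᶜ var₀)
    x₂ᶜ : ∀ {m} → Computable (suc m) (λ xs → x₂ (head xs))
    x₂ᶜ = gadgetᶜ (π₂ᶜ var₀)

    q : ℕ → ℕ → ℕ
    q n r = distWith (2 + answerˡ (x₁ n) (x₂ n) r) (2 + answerʳ (x₁ n) (x₂ n) r) (u n) (v n)

    qᶜ : Computable 2 (uncurry₂ q)
    qᶜ = distWithᶜ g-computable (sucᶜ (sucᶜ (answerˡᶜ x₁ᶜ x₂ᶜ var₁))) (sucᶜ (sucᶜ (answerʳᶜ x₁ᶜ x₂ᶜ var₁)))
                                (π₁ᶜ var₀) (π₂ᶜ var₀)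

proposition4p3 : (f : ℕ → ℕ) → ApproxFromAbove f →
    Σ CompGraph λ G → CompGraph.Connected G ×
      Σ (ℕ → ℕ) λ d → CompGraph.IsDistance G d × f ≤[ 2 ]btt d × d ≤[ 2 ]btt f
proposition4p3 f (g , g-computable , antitone , limit) = graph , connected , d , d-isDistance , f≤d , d≤f
  where open Construction f g g-computable antitone limit
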